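{- Let $G$ be a sequent calculus over $\mathcal{L}$ for a logic $L$ over $\mathcal{L}$ with $L\supseteq\mathsf{CK}$. Then $G+\mathbf{CK}$ is also a sequent calculus for $L$. The same holds if the triple $(\mathcal{L},\mathsf{CK},\mathbf{CK})$ is replaced by $(\mathcal{L}_\Box,\mathsf{CK}_\Box,\mathbf{CK}_\Box)$, by $(\mathcal{L}_\Diamond,\mathsf{BLL},\mathbf{BLL})$, or by $(\mathcal{L}_p,\mathsf{IPC},\mathbf{LJ})$.
   Context: $\mathcal{L}$: formulas built from atoms, $\top,\bot$ by $\wedge,\vee,\to,\Box,\Diamond$; $\mathcal{L}_\Box$ omits $\Diamond$, $\mathcal{L}_\Diamond$ omits $\Box$, $\mathcal{L}_p$ omits both. A logic over $\mathcal{L}$ or $\mathcal{L}_\Box$ is a set of formulas of that language closed under substitution, modus ponens and necessitation ($\varphi\in L\Rightarrow\Box\varphi\in L$); a logic over $\mathcal{L}_\Diamond$ or $\mathcal{L}_p$ is closed under substitution and modus ponens. $\mathsf{IPC}$ is intuitionistic propositional logic; $\mathsf{CK}$ is the smallest logic over $\mathcal{L}$ containing $\mathsf{IPC}$, $\Box(p\to q)\to(\Box p\to\Box q)$ and $\Box(p\to q)\to(\Diamond p\to\Diamond q)$; $\mathsf{CK}_\Box$ the smallest logic over $\mathcal{L}_\Box$ containing $\mathsf{IPC}$ and $\Box(p\to q)\to(\Box p\to\Box q)$; $\mathsf{BLL}$ the smallest logic over $\mathcal{L}_\Diamond$ containing $\mathsf{IPC}$ and $(p\to q)\to(\Diamond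 p\to\Diamond q)$. Sequents $\Sigma\Rightarrow\Lambda$ (finite multisets); rules are meta-sequents with schematic atoms and multiset variables; a sequent calculus is a finite set of rules; for calculi $G,H$, $G+H$ is their union. $G$ is a sequent calculus for $L$ if for every sequent, $G\vdash\Sigma\Rightarrow\Lambda$ iff $\bigwedge\Sigma\to\bigvee\Lambda\in L$. $\mathbf{LJ}$: single-conclusion calculus with $\Gamma,p\Rightarrow p$; $\Gamma,\bot\Rightarrow\Delta$; $\Gamma\Rightarrow\top$; left/right weakening; left contraction; cut $\frac{\Gamma\Rightarrow p\ \ \Gamma,p\Rightarrow\Delta}{\Gamma\Rightarrow\Delta}$; standard single-conclusion left/right rules for $\wedge,\vee,\to$. $\mathbf{CK}=\mathbf{LJ}+\{\frac{\Gamma\Rightarrow p}{\Box\Gamma\Rightarrow\Box p},\frac{\Gamma,p\Rightarrow q}{\Box\Gamma,\Diamond p\Rightarrow\Diamond q}\}$; $\mathbf{CK}_\Box=\mathbf{LJ}+\{\frac{\Gamma\Rightarrow p}{\Box\Gamma\Rightarrow\Box p}\}$; $\mathbf{BLL}=\mathbf{LJ}+\{\frac{\Gamma,p\Rightarrow q}{\Gamma,\Diamond p\Rightarrow\Diamond q}\}$. -}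

module Defs where

open import Data.Nat using (ℕ; _≤_)
open import Data.List using (List; []; _∷_; _++_; length; map; concatMap)
open import Data.List.Membership.Propositional using (_∈_)
open import Data.List.Relation.Unary.All using (All)
open import Data.List.Relation.Binary.Permutation.Propositional using (_↭_)
open import Data.Product using (_×_)

-- Languages: L (full), L_□, L_◇, L_p

data Lang : Set where
  full boxL diaL propL : Lang

data HasBox : Lang → Set where
  full : HasBox full
  boxL : HasBox boxL

data HasDia : Lang → Set where
  full : HasDia full
  diaL : HasDia diaL

infixr 6 _∧'_
infixr 5 _∨'_
infixr 4 _⇒'_

data Fm (ℓ : Lang) : Set where
  atom : ℕ → Fm ℓ
  ⊤' ⊥' : Fm ℓ
  _∧'_ _∨'_ _⇒'_ : Fm ℓ → Fm ℓ → Fm ℓ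
  □ : HasBox ℓ → Fm ℓ → Fm ℓ
  ◇ : HasDia ℓ → Fm ℓ → Fm ℓ

subst : ∀ {ℓ} → (ℕ → Fm ℓ) → Fm ℓ → Fm ℓ
subst σ (atom n) = σ n
subst σ ⊤' = ⊤'
subst σ ⊥' = ⊥'
subst σ (φ ∧' ψ) = subst σ φ ∧' subst σ ψ
subst σ (φ ∨' ψ) = subst σ φ ∨' subst σ ψ
subst σ (φ ⇒' ψ) = subst σ φ ⇒' subst σ ψ
subst σ (□ h φ) = □ h (subst σ φ)
subst σ (◇ h φ) = ◇ h (subst σ φ)

record IsLogic (ℓ : Lang) (L : Fm ℓ → Set) : Set where
  field
    closed-subst : ∀ (σ : ℕ → Fm ℓ) φ → L φ → L (subst σ φ)
    closed-mp    : ∀ φ ψ → L (φ ⇒' ψ) → L φ → L ψ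
    closed-nec   : ∀ (h : HasBox ℓ) φ → L φ → L (□ h φ)

p q r : ∀ {ℓ} → Fm ℓ
p = atom 0
q = atom 1
r = atom 2

-- Hilbert axioms of IPC (as formulas in atoms p q r; closure under
-- substitution is built into the logic generated below)
data IPCAx {ℓ : Lang} : Fm ℓ → Set where
  k    : IPCAx (p ⇒' (q ⇒' p))
  s    : IPCAx ((p ⇒' (q ⇒' r)) ⇒' ((p ⇒' q) ⇒' (p ⇒' r)))
  ∧e₁  : IPCAx (p ∧' q ⇒' p)
  ∧e₂  : IPCAx (p ∧' q ⇒' q)
  ∧i   : IPCAx (p ⇒' (q ⇒' p ∧' q))
  ∨i₁  : IPCAx (p ⇒' p ∨' q)
  ∨i₂  : IPCAx (q ⇒' p ∨' q)
  ∨e   : IPCAx ((p ⇒' r) ⇒' ((q ⇒' r) ⇒' (p ∨' q ⇒' r)))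
  efq  : IPCAx (⊥' ⇒' p)
  top  : IPCAx ⊤'

data ModalAx : (ℓ : Lang) → Fm ℓ → Set where
  CK-K□ : ModalAx full (□ full (p ⇒' q) ⇒' (□ full p ⇒' □ full q))
  CK-K◇ : ModalAx full (□ full (p ⇒' q) ⇒' (◇ full p ⇒' ◇ full q))
  CK□-K : ModalAx boxL (□ boxL (p ⇒' q) ⇒' (□ boxL p ⇒' □ boxL q))
  BLL-ax : ModalAx diaL ((p ⇒' q) ⇒' (◇ diaL p ⇒' ◇ diaL q))

-- Base ℓ: the smallest logic over ℓ containing IPC and ModalAx ℓ,
-- i.e. CK, CK_□, BLL, IPC for ℓ = full, boxL, diaL, propL.
data Base (ℓ : Lang) : Fm ℓ → Set where
  ipc : ∀ {φ} → IPCAx φ → Base ℓ φ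
  max : ∀ {φ} → ModalAx ℓ φ → Base ℓ φ
  sub : ∀ (σ : ℕ → Fm ℓ) {φ} → Base ℓ φ → Base ℓ (subst σ φ)
  mp  : ∀ {φ ψ} → Base ℓ (φ ⇒' ψ) → Base ℓ φ → Base ℓ ψ
  nec : ∀ (h : HasBox ℓ) {φ} → Base ℓ φ → Base ℓ (□ h φ)

-- Sequents (multisets represented by lists, taken up to permutation).
-- Single-conclusion: succedent has at most one formula.

record Seq (ℓ : Lang) : Set where
  constructor _⇒_
  field
    ante : List (Fm ℓ)
    succ : List (Fm ℓ)
open Seq public

SingleConc : ∀ {ℓ} → Seq ℓ → Set
SingleConc S = length (succ S) ≤ 1

⋀ : ∀ {ℓ} → List (Fm ℓ) → Fm ℓ
⋀ [] = ⊤'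
⋀ (φ ∷ []) = φ
⋀ (φ ∷ ψ ∷ xs) = φ ∧' ⋀ (ψ ∷ xs)

⋁ : ∀ {ℓ} → List (Fm ℓ) → Fm ℓ
⋁ [] = ⊥'
⋁ (φ ∷ []) = φ
⋁ (φ ∷ ψ ∷ xs) = φ ∨' ⋁ (ψ ∷ xs)

seqFm : ∀ {ℓ} → Seq ℓ → Fm ℓ
seqFm (Σ ⇒ Λ) = ⋀ Σ ⇒' ⋁ Λ

-- Rules: meta-sequents built from meta-formulas (formulas whose atoms
-- are schematic) and multiset variables (indexed by ℕ), the latter
-- possibly prefixed by modalities of the language (as in □Γ).

data Mod (ℓ : Lang) : Set where
  m□ : HasBox ℓ → Mod ℓ
  m◇ : HasDia ℓ → Mod ℓ

applyMods : ∀ {ℓ} → List (Mod ℓ) → Fm ℓ → Fm ℓ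
applyMods [] φ = φ
applyMods (m□ h ∷ ms) φ = □ h (applyMods ms φ)
applyMods (m◇ h ∷ ms) φ = ◇ h (applyMods ms φ)

data MElem (ℓ : Lang) : Set where
  fm  : Fm ℓ → MElem ℓ
  var : List (Mod ℓ) → ℕ → MElem ℓ      -- ○₁…○ₖ Γₙ

infix 3 _⇛_
infix 3 _⇒_

record MSeq (ℓ : Lang) : Set where
  constructor _⇛_
  field
    mante : List (MElem ℓ)
    msucc : List (MElem ℓ)
open MSeq public

record Rule (ℓ : Lang) : Set where
  constructor rule
  field
    prems : List (MSeq ℓ)
    concl : MSeq ℓ
open Rule public

Calculus : Lang → Set
Calculus ℓ = List (Rule ℓ)

_+ᶜ_ : ∀ {ℓ} → Calculus ℓ → Calculus ℓ → Calculus ℓ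
G +ᶜ H = G ++ H

instE : ∀ {ℓ} → (ℕ → Fm ℓ) → (ℕ → List (Fm ℓ)) → MElem ℓ → List (Fm ℓ)
instE σ τ (fm φ) = subst σ φ ∷ []
instE σ τ (var ms n) = map (applyMods ms) (τ n)

instM : ∀ {ℓ} → (ℕ → Fm ℓ) → (ℕ → List (Fm ℓ)) → List (MElem ℓ) → List (Fm ℓ)
instM σ τ = concatMap (instE σ τ)

instS : ∀ {ℓ} → (ℕ → Fm ℓ) → (ℕ → List (Fm ℓ)) → MSeq ℓ → Seq ℓ
instS σ τ (A ⇛ B) = instM σ τ A ⇒ instM σ τ B

data _⊢_ {ℓ : Lang} (G : Calculus ℓ) : Seq ℓ → Set where
  by : ∀ {S} (R : Rule ℓ) → R ∈ G →
       (σ : ℕ → Fm ℓ) (τ : ℕ → List (Fm ℓ)) →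
       SingleConc (instS σ τ (concl R)) →
       ante (instS σ τ (concl R)) ↭ ante S →
       succ (instS σ τ (concl R)) ↭ succ S →
       All (λ P → G ⊢ instS σ τ P) (prems R) →
       G ⊢ S

IsCalculusFor : ∀ {ℓ} → Calculus ℓ → (Fm ℓ → Set) → Set
IsCalculusFor G L = ∀ S → SingleConc S → (G ⊢ S → L (seqFm S)) × (L (seqFm S) → G ⊢ S)

private
  Γ Δ : ∀ {ℓ} → MElem ℓ
  Γ = var [] 0
  Δ = var [] 1
  P Q : ∀ {ℓ} → MElem ℓ
  P = fm p
  Q = fm q

LJ : ∀ {ℓ} → Calculus ℓ
LJ =
    rule [] (Γ ∷ P ∷ [] ⇛ P ∷ [])
  ∷ rule [] (Γ ∷ fm ⊥' ∷ [] ⇛ Δ ∷ [])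
  ∷ rule [] (Γ ∷ [] ⇛ fm ⊤' ∷ [])
  ∷ rule ((Γ ∷ [] ⇛ Δ ∷ []) ∷ []) (Γ ∷ P ∷ [] ⇛ Δ ∷ [])
  ∷ rule ((Γ ∷ [] ⇛ []) ∷ []) (Γ ∷ [] ⇛ P ∷ [])
  ∷ rule ((Γ ∷ P ∷ P ∷ [] ⇛ Δ ∷ []) ∷ []) (Γ ∷ P ∷ [] ⇛ Δ ∷ [])
  ∷ rule ((Γ ∷ [] ⇛ P ∷ []) ∷ (Γ ∷ P ∷ [] ⇛ Δ ∷ []) ∷ [])
         (Γ ∷ [] ⇛ Δ ∷ [])
  ∷ rule ((Γ ∷ P ∷ Q ∷ [] ⇛ Δ ∷ []) ∷ []) (Γ ∷ fm (p ∧' q) ∷ [] ⇛ Δ ∷ [])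
  ∷ rule ((Γ ∷ [] ⇛ P ∷ []) ∷ (Γ ∷ [] ⇛ Q ∷ []) ∷ [])
         (Γ ∷ [] ⇛ fm (p ∧' q) ∷ [])
  ∷ rule ((Γ ∷ P ∷ [] ⇛ Δ ∷ []) ∷ (Γ ∷ Q ∷ [] ⇛ Δ ∷ []) ∷ [])
         (Γ ∷ fm (p ∨' q) ∷ [] ⇛ Δ ∷ [])
  ∷ rule ((Γ ∷ [] ⇛ P ∷ []) ∷ []) (Γ ∷ [] ⇛ fm (p ∨' q) ∷ [])
  ∷ rule ((Γ ∷ [] ⇛ Q ∷ []) ∷ []) (Γ ∷ [] ⇛ fm (p ∨' q) ∷ [])
  ∷ rule ((Γ ∷ [] ⇛ P ∷ []) ∷ (Γ ∷ Q ∷ [] ⇛ Δ ∷ []) ∷ [])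
         (Γ ∷ fm (p ⇒' q) ∷ [] ⇛ Δ ∷ [])
  ∷ rule ((Γ ∷ P ∷ [] ⇛ Q ∷ []) ∷ []) (Γ ∷ [] ⇛ fm (p ⇒' q) ∷ [])
  ∷ []

box-rule : ∀ {ℓ} → HasBox ℓ → Rule ℓ
box-rule h = rule ((Γ ∷ [] ⇛ P ∷ []) ∷ []) (var (m□ h ∷ []) 0 ∷ [] ⇛ fm (□ h p) ∷ [])

dia-rule-CK : Rule full
dia-rule-CK = rule ((Γ ∷ P ∷ [] ⇛ Q ∷ []) ∷ [])
                   (var (m□ full ∷ []) 0 ∷ fm (◇ full p) ∷ [] ⇛ fm (◇ full q) ∷ [])

dia-rule-BLL : Rule diaL
dia-rule-BLL = rule ((Γ ∷ P ∷ [] ⇛ Q ∷ []) ∷ [])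
                    (Γ ∷ fm (◇ diaL p) ∷ [] ⇛ fm (◇ diaL q) ∷ [])

BaseCalc : (ℓ : Lang) → Calculus ℓ
BaseCalc full  = LJ +ᶜ (box-rule full ∷ dia-rule-CK ∷ [])
BaseCalc boxL  = LJ +ᶜ (box-rule boxL ∷ [])
BaseCalc diaL  = LJ +ᶜ (dia-rule-BLL ∷ [])
BaseCalc propL = LJ

-- Each rule of the base
-- calculus is sound for every logic L containing the base logic: this is
-- checked in the consequence relation Γ ⊩ φ generated by L and modus ponens,
-- where the IPC axioms give the deduction theorem and K with necessitation
-- lets □ (or ◇, via the ◇-axiom) pass over a whole context. Adding sound
-- rules to a calculus for L therefore proves nothing outside L, and it
-- still proves everything G proves.
module Submission where

open import Defs
open import Data.Nat using (ℕ; zero; suc; _≤_; s≤s)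
open import Data.Nat.Properties using (≤-trans; ≤-reflexive)
open import Data.List using (List; []; _∷_; _++_; length; map)
open import Data.List.Membership.Propositional using (_∈_)
open import Data.List.Membership.Propositional.Properties using (∈-map⁺; ∈-map⁻; ∈-++⁻; ∈-++⁺ʳ)
open import Data.List.Relation.Binary.Subset.Propositional using (_⊆_)
open import Data.List.Relation.Binary.Subset.Propositional.Properties using (xs⊆xs++ys; ⊆-reflexive)
open import Data.List.Properties using (++-identityʳ)
open import Data.List.Relation.Unary.Any using (here; there)
open import Data.List.Relation.Unary.All as All using (All; []; _∷_)
open import Data.List.Relation.Unary.All.Properties using (++⁺)
open import Data.List.Relation.Binary.Permutation.Propositional using (_↭_; ↭-sym)
open import Data.List.Relation.Binary.Permutation.Propositional.Properties
  using (∈-resp-↭; ↭-length; ↭-empty-inv; ↭-singleton-inv; ∷↭∷ʳ)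
open import Data.Product using (_,_; proj₁; proj₂)
open import Data.Sum using (inj₁; inj₂)
open import Relation.Binary.PropositionalEquality using (_≡_; refl; sym; cong)

⊢-single : ∀ {ℓ} {G : Calculus ℓ} {S} → G ⊢ S → SingleConc S
⊢-single (by R _ σ τ sc _ πₛ _) = ≤-trans (≤-reflexive (sym (↭-length πₛ))) sc

mutual
  ⊢-mono : ∀ {ℓ} {G G′ : Calculus ℓ} {S} → G ⊆ G′ → G ⊢ S → G′ ⊢ S
  ⊢-mono G⊆G′ (by R R∈G σ τ sc πₐ πₛ ds) = by R (G⊆G′ R∈G) σ τ sc πₐ πₛ (⊢-mono-All G⊆G′ ds)

  ⊢-mono-All : ∀ {ℓ} {G G′ : Calculus ℓ} {σ τ Ps} → G ⊆ G′ →
               All (λ P → G ⊢ instS σ τ P) Ps → All (λ P → G′ ⊢ instS σ τ P) Ps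
  ⊢-mono-All G⊆G′ [] = []
  ⊢-mono-All G⊆G′ (d ∷ ds) = ⊢-mono G⊆G′ d ∷ ⊢-mono-All G⊆G′ ds

⋁-resp-↭ : ∀ {ℓ} {xs ys : List (Fm ℓ)} → length xs ≤ 1 → xs ↭ ys → ⋁ xs ≡ ⋁ ys
⋁-resp-↭ {xs = []}         _ π = cong ⋁ (sym (↭-empty-inv (↭-sym π)))
⋁-resp-↭ {xs = _ ∷ []}     _ π = cong ⋁ (sym (↭-singleton-inv (↭-sym π)))
⋁-resp-↭ {xs = _ ∷ _ ∷ _} (s≤s ()) _

assignPQR : ∀ {ℓ} → Fm ℓ → Fm ℓ → Fm ℓ → ℕ → Fm ℓ
assignPQR a b c zero          = a
assignPQR a b c (suc zero)    = b
assignPQR a b c (suc (suc _)) = c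

K□ : ∀ {ℓ} (h : HasBox ℓ) → Base ℓ (□ h (p ⇒' q) ⇒' (□ h p ⇒' □ h q))
K□ full = max CK-K□
K□ boxL = max CK□-K

∈-map-□ : ∀ {ℓ} (h : HasBox ℓ) {xs : List (Fm ℓ)} {x} →
          x ∈ map (applyMods []) xs → □ h x ∈ map (applyMods (m□ h ∷ [])) xs
∈-map-□ h x∈ with ∈-map⁻ (applyMods []) x∈
... | _ , y∈ , refl = ∈-map⁺ (applyMods (m□ h ∷ [])) y∈

∈-++-last : ∀ {A : Set} (X : List A) {a} → a ∈ X ++ a ∷ []
∈-++-last X = ∈-++⁺ʳ X (here refl)

module Consequence (ℓ : Lang) (L : Fm ℓ → Set) (isL : IsLogic ℓ L)
                   (base : ∀ φ → Base ℓ φ → L φ) where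
  open IsLogic isL

  infix 2 _⊩_

  data _⊩_ (Γ : List (Fm ℓ)) : Fm ℓ → Set where
    hyp : ∀ {φ} → φ ∈ Γ → Γ ⊩ φ
    thm : ∀ {φ} → L φ → Γ ⊩ φ
    app : ∀ {φ ψ} → Γ ⊩ φ ⇒' ψ → Γ ⊩ φ → Γ ⊩ ψ

  ⊩-closed : ∀ {φ} → [] ⊩ φ → L φ
  ⊩-closed (thm x)   = x
  ⊩-closed (app f x) = closed-mp _ _ (⊩-closed f) (⊩-closed x)

  base-⊩ : ∀ {Γ φ} → Base ℓ φ → Γ ⊩ φ
  base-⊩ x = thm (base _ x)

  ipc-⊩ : ∀ {Γ φ} → IPCAx φ → (a b c : Fm ℓ) → Γ ⊩ subst (assignPQR a b c) φ
  ipc-⊩ x a b c = base-⊩ (sub (assignPQR a b c) (ipc x))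

  ⊩-⇒-refl : ∀ {Γ} a → Γ ⊩ a ⇒' a
  ⊩-⇒-refl a = app (app (ipc-⊩ s a (a ⇒' a) a) (ipc-⊩ k a (a ⇒' a) a)) (ipc-⊩ k a a a)

  deduction : ∀ {Γ a φ} → a ∷ Γ ⊩ φ → Γ ⊩ a ⇒' φ
  deduction {a = a} (hyp (here refl))  = ⊩-⇒-refl a
  deduction {a = a} (hyp (there φ∈Γ))  = app (ipc-⊩ k _ a a) (hyp φ∈Γ)
  deduction {a = a} (thm x)            = app (ipc-⊩ k _ a a) (thm x)
  deduction {a = a} (app {φ} {ψ} f x)  = app (app (ipc-⊩ s a φ ψ) (deduction f)) (deduction x)

  ⊩-cut : ∀ {Γ Δ φ} → (∀ {x} → x ∈ Γ → Δ ⊩ x) → Γ ⊩ φ → Δ ⊩ φ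
  ⊩-cut Δ⊩Γ (hyp x∈Γ) = Δ⊩Γ x∈Γ
  ⊩-cut Δ⊩Γ (thm x)   = thm x
  ⊩-cut Δ⊩Γ (app f x) = app (⊩-cut Δ⊩Γ f) (⊩-cut Δ⊩Γ x)

  ⊩-weaken : ∀ {Γ Δ φ} → Γ ⊆ Δ → Γ ⊩ φ → Δ ⊩ φ
  ⊩-weaken Γ⊆Δ = ⊩-cut (λ x∈Γ → hyp (Γ⊆Δ x∈Γ))

  ⊩-cut-++ : ∀ X {ys zs φ} → All (λ y → X ++ zs ⊩ y) ys → X ++ ys ⊩ φ → X ++ zs ⊩ φ
  ⊩-cut-++ X {ys} {zs} ⊩ys = ⊩-cut split
    where
    split : ∀ {x} → x ∈ X ++ ys → X ++ zs ⊩ x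
    split x∈ with ∈-++⁻ X x∈
    ... | inj₁ x∈X  = hyp (xs⊆xs++ys X zs x∈X)
    ... | inj₂ x∈ys = All.lookup ⊩ys x∈ys

  deduction-last : ∀ X {a φ} → X ++ a ∷ [] ⊩ φ → X ⊩ a ⇒' φ
  deduction-last X {a} t = deduction (⊩-weaken (∈-resp-↭ (↭-sym (∷↭∷ʳ a X))) t)

  explode : ∀ {Γ} φ → Γ ⊩ ⊥' → Γ ⊩ φ
  explode φ t = app (ipc-⊩ efq φ φ φ) t

  ⋀-intro : ∀ {Δ} xs → (∀ {x} → x ∈ xs → Δ ⊩ x) → Δ ⊩ ⋀ xs
  ⋀-intro []           _   = ipc-⊩ top ⊤' ⊤' ⊤'
  ⋀-intro (x ∷ [])     ⊩xs = ⊩xs (here refl)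
  ⋀-intro (x ∷ y ∷ xs) ⊩xs =
    app (app (ipc-⊩ ∧i x (⋀ (y ∷ xs)) x) (⊩xs (here refl))) (⋀-intro (y ∷ xs) (λ m → ⊩xs (there m)))

  ⋀-elim : ∀ {Δ} xs → Δ ⊩ ⋀ xs → ∀ {x} → x ∈ xs → Δ ⊩ x
  ⋀-elim (x ∷ [])     t (here refl) = t
  ⋀-elim (x ∷ y ∷ xs) t (here refl) = app (ipc-⊩ ∧e₁ x (⋀ (y ∷ xs)) x) t
  ⋀-elim (x ∷ y ∷ xs) t (there x∈)  = ⋀-elim (y ∷ xs) (app (ipc-⊩ ∧e₂ x (⋀ (y ∷ xs)) x) t) x∈

  Valid : Seq ℓ → Set
  Valid (Σ ⇒ Λ) = Σ ⊩ ⋁ Λ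

  L⇒Valid : ∀ S → L (seqFm S) → Valid S
  L⇒Valid (Σ ⇒ Λ) x = app (thm x) (⋀-intro Σ hyp)

  Valid⇒L : ∀ S → Valid S → L (seqFm S)
  Valid⇒L (Σ ⇒ Λ) t = ⊩-closed (deduction (⊩-cut (⋀-elim Σ (hyp (here refl))) t))

  Valid-resp-↭ : ∀ {S T} → SingleConc S → ante S ↭ ante T → succ S ↭ succ T → Valid S → Valid T
  Valid-resp-↭ {Σ ⇒ Λ} sc πₐ πₛ t rewrite ⋁-resp-↭ sc πₛ = ⊩-weaken (∈-resp-↭ πₐ) t

  _⇒*_ : List (Fm ℓ) → Fm ℓ → Fm ℓ
  []       ⇒* φ = φ
  (a ∷ xs) ⇒* φ = xs ⇒* (a ⇒' φ)

  deduction* : ∀ xs {φ} → xs ⊩ φ → L (xs ⇒* φ)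
  deduction* []       t = ⊩-closed t
  deduction* (a ∷ xs) t = deduction* xs (deduction t)

  □-⇒*-elim : ∀ (h : HasBox ℓ) {Δ} xs {φ} → Δ ⊩ □ h (xs ⇒* φ) → (∀ {x} → x ∈ xs → Δ ⊩ □ h x) → Δ ⊩ □ h φ
  □-⇒*-elim h []       t _    = t
  □-⇒*-elim h (a ∷ xs) t ⊩□xs =
    app (app (base-⊩ (sub (assignPQR a _ a) (K□ h))) (□-⇒*-elim h xs t (λ x∈ → ⊩□xs (there x∈)))) (⊩□xs (here refl))

  □-intro : ∀ (h : HasBox ℓ) {Δ} xs {φ} → xs ⊩ φ → (∀ {x} → x ∈ xs → Δ ⊩ □ h x) → Δ ⊩ □ h φ
  □-intro h xs t = □-⇒*-elim h xs (thm (closed-nec h _ (deduction* xs t)))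

  SoundRule : Rule ℓ → Set
  SoundRule R = ∀ σ τ → All (λ P → Valid (instS σ τ P)) (prems R) → Valid (instS σ τ (concl R))

  LJ-sound : All SoundRule LJ
  LJ-sound =
      (λ { σ τ [] → hyp (∈-++-last _) })
    ∷ (λ { σ τ [] → explode _ (hyp (∈-++-last _)) })
    ∷ (λ { σ τ [] → ipc-⊩ top ⊤' ⊤' ⊤' })
    ∷ (λ { σ τ (t ∷ []) → ⊩-cut-++ _ [] t })
    ∷ (λ { σ τ (t ∷ []) → explode _ t })
    ∷ (λ { σ τ (t ∷ []) → ⊩-cut-++ _ (hyp (∈-++-last _) ∷ hyp (∈-++-last _) ∷ []) t })
    ∷ (λ { σ τ (t₁ ∷ t₂ ∷ []) → ⊩-cut-++ _ (t₁ ∷ []) t₂ })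
    ∷ (λ { σ τ (t ∷ []) → ⊩-cut-++ _ (app (ipc-⊩ ∧e₁ (σ 0) (σ 1) (σ 0)) (hyp (∈-++-last _))
                                    ∷ app (ipc-⊩ ∧e₂ (σ 0) (σ 1) (σ 0)) (hyp (∈-++-last _)) ∷ []) t })
    ∷ (λ { σ τ (t₁ ∷ t₂ ∷ []) → app (app (ipc-⊩ ∧i (σ 0) (σ 1) (σ 0)) t₁) t₂ })
    ∷ (λ { σ τ (t₁ ∷ t₂ ∷ []) →
           app (app (app (ipc-⊩ ∨e (σ 0) (σ 1) _) (⊩-weaken (xs⊆xs++ys _ _) (deduction-last _ t₁)))
                                                   (⊩-weaken (xs⊆xs++ys _ _) (deduction-last _ t₂)))
               (hyp (∈-++-last _)) })
    ∷ (λ { σ τ (t ∷ []) → app (ipc-⊩ ∨i₁ (σ 0) (σ 1) (σ 0)) t })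
    ∷ (λ { σ τ (t ∷ []) → app (ipc-⊩ ∨i₂ (σ 0) (σ 1) (σ 0)) t })
    ∷ (λ { σ τ (t₁ ∷ t₂ ∷ []) →
           ⊩-cut-++ _ (app (hyp (∈-++-last _)) (⊩-cut-++ _ [] t₁) ∷ []) t₂ })
    ∷ (λ { σ τ (t ∷ []) → ⊩-weaken (xs⊆xs++ys _ _) (deduction-last _ t) })
    ∷ []

  □-sound : (h : HasBox ℓ) → SoundRule (box-rule h)
  □-sound h σ τ (t ∷ []) =
    □-intro h _ (⊩-weaken (⊆-reflexive (++-identityʳ _)) t) (λ x∈ → hyp (xs⊆xs++ys _ [] (∈-map-□ h x∈)))

  sound-extension : ∀ {G H} → IsCalculusFor G L → All SoundRule H → IsCalculusFor (G +ᶜ H) L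
  sound-extension {G} {H} G-for-L H-sound S sc =
    soundness , λ x → ⊢-mono (xs⊆xs++ys G H) (proj₂ (G-for-L S sc) x)
    where
    mutual
      soundness : ∀ {S} → (G +ᶜ H) ⊢ S → L (seqFm S)
      soundness {S} d@(by R R∈ σ τ sc πₐ πₛ ds) with ∈-++⁻ G R∈
      ... | inj₁ R∈G = proj₁ (G-for-L S (⊢-single d)) (by R R∈G σ τ sc πₐ πₛ (prems-in-G ds))
      ... | inj₂ R∈H = Valid⇒L S (Valid-resp-↭ sc πₐ πₛ (All.lookup H-sound R∈H σ τ (prems-valid ds)))

      prems-in-G : ∀ {σ τ Ps} → All (λ P → (G +ᶜ H) ⊢ instS σ τ P) Ps → All (λ P → G ⊢ instS σ τ P) Ps
      prems-in-G [] = []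
      prems-in-G {σ} {τ} {P ∷ _} (d ∷ ds) = proj₂ (G-for-L (instS σ τ P) (⊢-single d)) (soundness d) ∷ prems-in-G ds

      prems-valid : ∀ {σ τ Ps} → All (λ P → (G +ᶜ H) ⊢ instS σ τ P) Ps → All (λ P → Valid (instS σ τ P)) Ps
      prems-valid [] = []
      prems-valid {σ} {τ} {P ∷ _} (d ∷ ds) = L⇒Valid (instS σ τ P) (soundness d) ∷ prems-valid ds

module _ (L : Fm full → Set) (isL : IsLogic full L) (base : ∀ φ → Base full φ → L φ) where
  open Consequence full L isL base

  ◇-CK-sound : SoundRule dia-rule-CK
  ◇-CK-sound σ τ (t ∷ []) = app (app K◇ (□-intro full _ (deduction-last _ t) ⊩□Γ)) (hyp (∈-++-last _))
    where
    K◇ : ∀ {Δ} → Δ ⊩ □ full (σ 0 ⇒' σ 1) ⇒' (◇ full (σ 0) ⇒' ◇ full (σ 1))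
    K◇ = base-⊩ (sub (assignPQR (σ 0) (σ 1) (σ 0)) (max CK-K◇))

    ⊩□Γ : ∀ {x} → x ∈ map (applyMods []) (τ 0) →
          map (applyMods (m□ full ∷ [])) (τ 0) ++ ◇ full (σ 0) ∷ [] ⊩ □ full x
    ⊩□Γ x∈ = hyp (xs⊆xs++ys _ _ (∈-map-□ full x∈))

module _ (L : Fm diaL → Set) (isL : IsLogic diaL L) (base : ∀ φ → Base diaL φ → L φ) where
  open Consequence diaL L isL base

  ◇-BLL-sound : SoundRule dia-rule-BLL
  ◇-BLL-sound σ τ (t ∷ []) =
    app (app (base-⊩ (sub (assignPQR (σ 0) (σ 1) (σ 0)) (max BLL-ax))) (⊩-weaken (xs⊆xs++ys _ _) (deduction-last _ t)))
        (hyp (∈-++-last _))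

BaseCalc-sound : ∀ ℓ L isL base → All (Consequence.SoundRule ℓ L isL base) (BaseCalc ℓ)
BaseCalc-sound full  L isL base = ++⁺ LJ-sound (□-sound full ∷ ◇-CK-sound L isL base ∷ [])
  where open Consequence full L isL base
BaseCalc-sound boxL  L isL base = ++⁺ LJ-sound (□-sound boxL ∷ [])
  where open Consequence boxL L isL base
BaseCalc-sound diaL  L isL base = ++⁺ LJ-sound (◇-BLL-sound L isL base ∷ [])
  where open Consequence diaL L isL base
BaseCalc-sound propL L isL base = LJ-sound
  where open Consequence propL L isL base

lemma2p7 : (ℓ : Lang) (G : Calculus ℓ) (L : Fm ℓ → Set) →
    IsLogic ℓ L → (∀ φ → Base ℓ φ → L φ) →
    IsCalculusFor G L → IsCalculusFor (G +ᶜ BaseCalc ℓ) L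
lemma2p7 ℓ G L isL base G-for-L = sound-extension G-for-L (BaseCalc-sound ℓ L isL base)
  where open Consequence ℓ L isL base
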